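{- Let $k,a,b$ be positive integers such that $k=a+b$ and $4<2a\le k$. Then \[\binom{2k}{k}\neq\binom{2a}{a}\binom{a+2b-1}{b}.\] -}

module Defs where

-- Fix a and let b grow, with k = a + b. Raising b by one multiplies C(2k,k) by
-- 2(2k+1)/(k+1) and C(a+2b-1,b) by (a+2b+1)(a+2b)/((b+1)(a+b)); for a ≥ 3 the second
-- factor is at least the first, so the strict inequality C(2k,k) < C(2a,a) C(a+2b-1,b)
-- propagates from b = 1, where it reads 2(2a+1) < (a+1)². Both factors come from the
-- absorption identity (m+1) C(m+n+1,m+1) = (m+n+1) C(m+n,m).
{-# OPTIONS --safe #-}
module Submission where

open import Defs
open import Data.Nat using (ℕ; _+_; _*_; _∸_; _≤_; _<_)
open import Data.Nat.Combinatorics using (_C_)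
open import Relation.Binary.PropositionalEquality using (_≢_; _≡_)

open import Data.Nat.Base using (zero; suc; _!; NonZero; s≤s; +-rawMagma)
open import Algebra.Definitions.RawMagma +-rawMagma using (_,_)
open import Data.Nat.Combinatorics using (nCk≡n!/k![n-k]!; k![n∸k]!∣n!; nCk≡nC[n∸k]; nC1≡n)
open import Data.Nat.DivMod using (_/_; m/n*n≡m)
open import Data.Nat.Properties
open import Data.Nat.Tactic.RingSolver using (solve-∀)
open import Algebra.Properties.CommutativeSemigroup *-commutativeSemigroup using (x∙yz≈y∙xz; xy∙z≈y∙xz)
open import Relation.Binary.PropositionalEquality using (refl; sym; trans; cong; cong₂; subst; subst₂; module ≡-Reasoning)

C-factorial : ∀ m n → ((m + n) C m) * (m ! * n !) ≡ (m + n) !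
C-factorial m n = begin
    ((m + n) C m) * (m ! * n !) ≡⟨ cong (λ l → ((m + n) C m) * (m ! * l !)) (m+n∸m≡n m n) ⟨
    ((m + n) C m) * d           ≡⟨ cong (_* d) (nCk≡n!/k![n-k]! (m≤m+n m n)) ⟩
    (m + n) ! / d * d           ≡⟨ m/n*n≡m (k![n∸k]!∣n! (m≤m+n m n)) ⟩
    (m + n) !                   ∎
  where
  open ≡-Reasoning
  d = m ! * (m + n ∸ m) !
  instance
    _ : NonZero d
    _ = m !* (m + n ∸ m) !≢0

C-nonZero : ∀ m n → NonZero ((m + n) C m)
C-nonZero m n = m*n≢0⇒m≢0 _ {{subst NonZero (sym (C-factorial m n)) ((m + n) !≢0)}}

C-sym : ∀ m n → (m + n) C m ≡ (n + m) C n
C-sym m n = begin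
    (m + n) C m           ≡⟨ nCk≡nC[n∸k] (m≤m+n m n) ⟩
    (m + n) C (m + n ∸ m) ≡⟨ cong ((m + n) C_) (m+n∸m≡n m n) ⟩
    (m + n) C n           ≡⟨ cong (_C n) (+-comm m n) ⟩
    (n + m) C n           ∎
  where open ≡-Reasoning

C-absorbˡ : ∀ m n → suc m * ((suc m + n) C suc m) ≡ suc (m + n) * ((m + n) C m)
C-absorbˡ m n = *-cancelʳ-≡ _ _ (m ! * n !) {{m !* n !≢0}} (begin
    suc m * B′ * (m ! * n !)        ≡⟨ xy∙z≈y∙xz (suc m) B′ (m ! * n !) ⟩
    B′ * (suc m * (m ! * n !))      ≡⟨ cong (B′ *_) (*-assoc (suc m) (m !) (n !)) ⟨
    B′ * (suc m ! * n !)            ≡⟨ C-factorial (suc m) n ⟩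
    suc (m + n) * (m + n) !         ≡⟨ cong (suc (m + n) *_) (C-factorial m n) ⟨
    suc (m + n) * (B * (m ! * n !)) ≡⟨ *-assoc (suc (m + n)) B (m ! * n !) ⟨
    suc (m + n) * B * (m ! * n !)   ∎)
  where
  open ≡-Reasoning
  B′ = (suc m + n) C suc m
  B = (m + n) C m

C-absorbʳ : ∀ m n → suc n * ((m + suc n) C m) ≡ suc (m + n) * ((m + n) C m)
C-absorbʳ m n = begin
    suc n * ((m + suc n) C m)     ≡⟨ cong (suc n *_) (C-sym m (suc n)) ⟩
    suc n * ((suc n + m) C suc n) ≡⟨ C-absorbˡ n m ⟩
    suc (n + m) * ((n + m) C n)   ≡⟨ cong₂ _*_ (cong suc (+-comm n m)) (C-sym n m) ⟩
    suc (m + n) * ((m + n) C m)   ∎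
  where open ≡-Reasoning

C-diagonal-step : ∀ m n → suc m * suc n * ((suc m + suc n) C suc m)
                   ≡ suc (m + suc n) * suc (m + n) * ((m + n) C m)
C-diagonal-step m n = begin
    suc m * suc n * B″                 ≡⟨ xy∙z≈y∙xz (suc m) (suc n) B″ ⟩
    suc n * (suc m * B″)               ≡⟨ cong (suc n *_) (C-absorbˡ m (suc n)) ⟩
    suc n * (suc (m + suc n) * B′)     ≡⟨ x∙yz≈y∙xz (suc n) (suc (m + suc n)) B′ ⟩
    suc (m + suc n) * (suc n * B′)     ≡⟨ cong (suc (m + suc n) *_) (C-absorbʳ m n) ⟩
    suc (m + suc n) * (suc (m + n) * B) ≡⟨ *-assoc (suc (m + suc n)) (suc (m + n)) B ⟨
    suc (m + suc n) * suc (m + n) * B  ∎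
  where
  open ≡-Reasoning
  B″ = (suc m + suc n) C suc m
  B′ = (m + suc n) C m
  B = (m + n) C m

<-step-by-ratios : ∀ {g g′ f f′} p q r s .{{_ : NonZero (s * p)}} →
                   p * g′ ≡ q * g → r * f′ ≡ s * f → q * r ≤ s * p → g < f → g′ < f′
<-step-by-ratios {g} {g′} {f} {f′} p q r s pg′≡qg rf′≡sf qr≤sp g<f =
  *-cancelˡ-< (p * r) g′ f′ (begin-strict
    p * r * g′   ≡⟨ xy∙z≈y∙xz p r g′ ⟩
    r * (p * g′) ≡⟨ cong (r *_) pg′≡qg ⟩
    r * (q * g)  ≡⟨ xy∙z≈y∙xz q r g ⟨
    q * r * g    ≤⟨ *-monoˡ-≤ g qr≤sp ⟩
    s * p * g    <⟨ *-monoʳ-< (s * p) g<f ⟩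
    s * p * f    ≡⟨ xy∙z≈y∙xz s p f ⟩
    p * (s * f)  ≡⟨ cong (p *_) rf′≡sf ⟨
    p * (r * f′) ≡⟨ *-assoc p r f′ ⟨
    p * r * f′   ∎)
  where open ≤-Reasoning

-- Encoding a ≥ 3 as a = 3 + x turns the polynomial inequalities below into
-- identities with a slack polynomial whose coefficients are all nonnegative.
module _ (x : ℕ) where

  private
    a : ℕ
    a = 3 + x

  base-ratio< : suc (a + suc a) * suc (a + a) < suc a * suc a * suc a
  base-ratio< = ≤″⇒≤ (_ , slack x)
    where
    slack : ∀ x → let a = 3 + x in
      suc (suc (a + suc a) * suc (a + a) + (x * x * x + 8 * x * x + 18 * x + 7))
      ≡ suc a * suc a * suc a
    slack = solve-∀

  step-ratio≤ : ∀ c → let K = suc (a + c) ; m = suc c ; n = a + c in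
    suc (K + suc K) * suc (K + K) * (suc m * suc n) ≤ suc (m + suc n) * suc (m + n) * (suc K * suc K)
  step-ratio≤ c = ≤″⇒≤ (_ , slack x c)
    where
    slack : ∀ x c → let a = 3 + x ; K = suc (a + c) ; m = suc c ; n = a + c in
      suc (K + suc K) * suc (K + K) * (suc m * suc n)
      + (30 + 6 * c + 91 * x + 32 * x * c + 3 * x * c * c + 57 * x * x + 16 * x * x * c
         + x * x * c * c + 13 * x * x * x + 2 * x * x * x * c + x * x * x * x)
      ≡ suc (m + suc n) * suc (m + n) * (suc K * suc K)
    slack = solve-∀

  central<product-base : (suc a + suc a) C suc a < ((a + a) C a) * ((1 + a) C 1)
  central<product-base = *-cancelˡ-< (suc a * suc a) G′ (G * ((1 + a) C 1)) (begin-strict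
      suc a * suc a * G′                ≡⟨ C-diagonal-step a a ⟩
      suc (a + suc a) * suc (a + a) * G <⟨ *-monoˡ-< G {{C-nonZero a a}} base-ratio< ⟩
      suc a * suc a * suc a * G         ≡⟨ *-assoc (suc a * suc a) (suc a) G ⟩
      suc a * suc a * (suc a * G)       ≡⟨ cong (suc a * suc a *_) (*-comm (suc a) G) ⟩
      suc a * suc a * (G * suc a)       ≡⟨ cong (λ t → suc a * suc a * (G * t)) (nC1≡n (suc a)) ⟨
      suc a * suc a * (G * ((1 + a) C 1)) ∎)
    where
    open ≤-Reasoning
    G′ = (suc a + suc a) C suc a
    G = (a + a) C a

  central<product : ∀ c → let n = a + c in
                    (suc n + suc n) C suc n < ((a + a) C a) * ((suc c + n) C suc c)
  central<product zero = subst (λ n → (suc n + suc n) C suc n < ((a + a) C a) * ((1 + n) C 1))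
    (sym (+-identityʳ a)) central<product-base
  central<product (suc c) = subst (λ n → (suc n + suc n) C suc n < G * ((suc m + n) C suc m))
    (sym (+-suc a c))
    (<-step-by-ratios p q r s (C-diagonal-step K K) scaled-ratio (step-ratio≤ c) (central<product c))
    where
    open ≡-Reasoning
    G = (a + a) C a
    K = suc (a + c)
    m = suc c
    n = a + c
    p = suc K * suc K
    q = suc (K + suc K) * suc (K + K)
    r = suc m * suc n
    s = suc (m + suc n) * suc (m + n)
    X′ = (suc m + suc n) C suc m
    X = (m + n) C m
    scaled-ratio : r * (G * X′) ≡ s * (G * X)
    scaled-ratio = begin
      r * (G * X′) ≡⟨ x∙yz≈y∙xz r G X′ ⟩
      G * (r * X′) ≡⟨ cong (G *_) (C-diagonal-step m n) ⟩
      G * (s * X)  ≡⟨ x∙yz≈y∙xz G s X ⟩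
      s * (G * X)  ∎

lemma2p3 : (k a b : ℕ) → 0 < k → 0 < a → 0 < b → k ≡ a + b → 4 < 2 * a → 2 * a ≤ k →
    (2 * k) C k ≢ ((2 * a) C a) * ((a + 2 * b ∸ 1) C b)
lemma2p3 _ 0 _ _ _ _ _ () _
lemma2p3 _ 1 _ _ _ _ _ (s≤s (s≤s ())) _
lemma2p3 _ 2 _ _ _ _ _ (s≤s (s≤s (s≤s (s≤s ())))) _
lemma2p3 _ _ 0 _ _ () _ _ _
lemma2p3 _ a@(suc (suc (suc x))) (suc c) _ _ _ refl _ _ =
  <⇒≢ (subst₂ _<_ central≡ product≡ (central<product x c))
  where
  2*n≡n+n : ∀ n → 2 * n ≡ n + n
  2*n≡n+n n = cong (n +_) (+-identityʳ n)
  a+2[1+c]≡2+c+[a+c] : ∀ a c → a + 2 * suc c ≡ suc (suc c + (a + c))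
  a+2[1+c]≡2+c+[a+c] = solve-∀
  central≡ : (suc (a + c) + suc (a + c)) C suc (a + c) ≡ (2 * (a + suc c)) C (a + suc c)
  central≡ = sym (trans (cong (λ k → (2 * k) C k) (+-suc a c))
                        (cong (_C suc (a + c)) (2*n≡n+n (suc (a + c)))))
  product≡ : ((a + a) C a) * ((suc c + (a + c)) C suc c)
           ≡ ((2 * a) C a) * ((a + 2 * suc c ∸ 1) C suc c)
  product≡ = cong₂ _*_ (cong (_C a) (sym (2*n≡n+n a)))
                       (cong (λ t → (t ∸ 1) C suc c) (sym (a+2[1+c]≡2+c+[a+c] a c)))
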